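{- Let $n\ge 1$, let $\lambda=(\lambda_1,\lambda_2,\ldots,\lambda_k)$ be a composition of $n$ and let $d\ge 0$ be an integer. The number of $\lambda$-unimodal permutations $\pi\in\mathcal{S}_n$ with $\operatorname{des}_\lambda(\pi)=d$ equals \[\binom{n}{\lambda}\binom{n-k}{d},\qquad\text{where } \binom{n}{\lambda}=\frac{n!}{\lambda_1!\lambda_2!\cdots\lambda_k!}.\]
   Context: $\mathcal{S}_n$ is the set of permutations of $[n]=\{1,\ldots,n\}$, written in one-line notation $\pi=\pi_1\pi_2\cdots\pi_n$. A composition of $n$ is a sequence of positive integers $(\lambda_1,\ldots,\lambda_k)$ with $\sum\lambda_i=n$. A sequence is unimodal if it is strictly increasing and then strictly decreasing, i.e. there is an index $i$ with the entries strictly increasing up to position $i$ and strictly decreasing from position $i$ on. A permutation $\pi\in\mathcal{S}_n$ is $\lambda$-unimodal if, when its one-line notation is cut into $k$ consecutive segments of lengths $\lambda_1,\ldots,\lambda_k$, each segment is unimodal. The permutation $\pi$ has a descent at position $i$ if $\pi_i>\pi_{i+1}$; $\operatorname{Des}(\pi)$ is the set of descents. The set of $\lambda$-descents is $\operatorname{Des}_\lambda(\pi)=\operatorname{Des}(\pi)\setminus\{\lambda_1,\lambda_1+\lambda_2,\ldots,\lambda_1+\cdots+\lambda_{k-1}\}$, and $\operatorname{des}_\lambda(\pi)=|\operatorname{Des}_\lambda(\pi)|$. -}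

module Defs where

open import Data.Nat using (ℕ; zero; suc; _+_; _*_; _∸_; _<_; _>_; _!; _/_; NonZero; _<ᵇ_; _≟_)
open import Data.Nat.Properties using (_!≢0; m*n≢0)
open import Data.Nat.Combinatorics using (_C_)
open import Data.Bool using (if_then_else_)
open import Data.List using (List; []; _∷_; map; take; drop; length; filter)
open import Data.Nat.ListAction using (sum; product)
open import Data.List.Relation.Unary.All using (All)
open import Data.List.Relation.Unary.Linked using (Linked)
open import Data.List.Membership.DecPropositional _≟_ using (_∉?_)
open import Data.Fin using (Fin; toℕ)
open import Data.Vec using (Vec; toList)
open import Data.Product using (Σ; ∃; _×_)
open import Relation.Binary.PropositionalEquality using (_≡_)

IsComposition : ℕ → List ℕ → Set
IsComposition n λs = All (0 <_) λs × sum λs ≡ n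

-- Words of length n over Fin n (one-line notation, entries 0..n-1
-- standing for 1..n; only relative order matters for everything below).
Word : ℕ → Set
Word n = Vec (Fin n) n

entries : ∀ {n} → Word n → List ℕ
entries π = map toℕ (toList π)

-- π is a permutation of [n]: i ↦ π_i is injective (hence bijective on Fin n).
open import Function.Definitions using (Injective)
open import Data.Vec using (lookup)

IsPerm : ∀ {n} → Word n → Set
IsPerm π = Injective _≡_ _≡_ (lookup π)

Unimodal : List ℕ → Set
Unimodal xs = ∃ λ i → Linked _<_ (take (suc i) xs) × Linked _>_ (drop i xs)

segments : List ℕ → List ℕ → List (List ℕ)
segments [] xs = []
segments (l ∷ ls) xs = take l xs ∷ segments ls (drop l xs)

LambdaUnimodal : ∀ {n} → List ℕ → Word n → Set
LambdaUnimodal λs π = All Unimodal (segments λs (entries π))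

-- Des: the (1-based) positions i with x_i > x_{i+1}.
Des : List ℕ → List ℕ
Des [] = []
Des (x ∷ []) = []
Des (x ∷ y ∷ r) =
  let rest = map suc (Des (y ∷ r)) in
  if y <ᵇ x then 1 ∷ rest else rest

boundaries : List ℕ → List ℕ
boundaries [] = []
boundaries (l ∷ []) = []
boundaries (l ∷ l' ∷ r) = l ∷ map (l +_) (boundaries (l' ∷ r))

Desλ : ∀ {n} → List ℕ → Word n → List ℕ
Desλ λs π = filter (_∉? boundaries λs) (Des (entries π))

desλ : ∀ {n} → List ℕ → Word n → ℕ
desλ λs π = length (Desλ λs π)

prodFact : List ℕ → ℕ
prodFact λs = product (map _! λs)

prodFact≢0 : ∀ λs → NonZero (prodFact λs)
prodFact≢0 [] = _
prodFact≢0 (l ∷ ls) = m*n≢0 (l !) (prodFact ls) {{l !≢0}} {{prodFact≢0 ls}}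

multinomial : ℕ → List ℕ → ℕ
multinomial n λs = _/_ (n !) (prodFact λs) {{prodFact≢0 λs}}

module Submission where

-- The entries of a λ-unimodal permutation, cut at the block boundaries, form k unimodal blocks
-- of sizes λ₁, …, λ_k filled with the values 0, …, n−1, and its λ-descents are exactly the
-- descents inside the blocks. The smallest value of a unimodal block is its first or its last
-- entry, and deleting it leaves a unimodal block; at the front it makes no descent, at the back
-- (possible only in a block of size at least two) exactly one. So the fillings of an arbitrary
-- shape c = (c₁, …, c_k), parts possibly 0, by a, …, a+N−1 with d descents arise exactly once by
-- inserting a into fillings by a+1, …, a+N−1, and their number F(N, c, d) satisfies
--   F(N, c, d) · ∏ cᵢ! = N! · C(N − m, d),   m = #{i | cᵢ > 0}.
-- Inserting into a part of size 1 raises m by one; for a larger part the two ends combine by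
-- Pascal's rule C(M, d) + C(M, d−1) = C(M+1, d); weighting part i by cᵢ and summing gives the
-- factor N + 1. For a composition m = k, and the case d = 0 identifies F(n, λ, 0) with the
-- multinomial coefficient.

open import Defs

open import Relation.Binary.PropositionalEquality
open import Data.Nat using (ℕ; zero; suc; _+_; _*_; _∸_; _≤_; _<_; _>_; _≥_; z≤n; s≤s; z<s; s<s;
  _<ᵇ_; _≟_; _!; NonZero)
open import Data.Nat.Properties
open import Algebra.Properties.CommutativeSemigroup +-commutativeSemigroup
  using () renaming (x∙yz≈y∙xz to +-left-comm)
open import Algebra.Properties.CommutativeSemigroup *-commutativeSemigroup
  using () renaming (x∙yz≈y∙xz to *-left-comm; xy∙z≈xz∙y to *-right-comm)
open import Data.Nat.Combinatorics using (_C_; nCk+nC[k+1]≡[n+1]C[k+1])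
open import Data.Nat.DivMod using (_/_; _mod_; m*n/n≡m; m<n⇒m%n≡m)
open import Data.Nat.ListAction using (sum; product)
open import Data.Nat.ListAction.Properties using (sum-++; product-++)
open import Data.Bool using (true; false; T; if_then_else_)
open import Data.Bool.Properties using (T-≡)
open import Data.Empty using (⊥-elim)
open import Data.Product using (Σ; ∃; ∃₂; _×_; _,_; proj₁; proj₂)
open import Data.Sum using (_⊎_; inj₁; inj₂)
open import Data.Fin using (Fin; zero; suc; toℕ; fromℕ<; punchOut) renaming (_≟_ to _≟ᶠ_)
open import Data.Fin.Properties
  using (any?; injective⇒≤; punchOut-injective; toℕ-injective; toℕ<n; toℕ-fromℕ<)
open import Data.Vec using (Vec; []; _∷_; toList; lookup)
open import Data.Vec.Properties using (toList-injective; length-toList; cast-is-id)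
open import Data.List using (List; []; _∷_; _++_; _∷ʳ_; map; take; drop; length; concat; filter; tabulate)
open import Data.List.Properties
  using (∷-injective; ∷-injectiveˡ; ∷-injectiveʳ; ∷ʳ-injectiveˡ; ∷ʳ-++; length-map; length-++;
         length-take; length-drop; take++drop≡id; map-++; map-∘; map-id; map-cong-local;
         map-tabulate; map-injective; concat-++; ++-identityʳ; filter-++; filter-accept; filter-reject)
open import Data.List.Membership.Propositional using (_∈_; _∉_)
open import Data.List.Membership.Propositional.Properties
  using (∈-map⁺; ∈-map⁻; ∈-++⁺ˡ; ∈-++⁺ʳ; ∈-++⁻; ∈-concat⁻′; ∈-∃++)
open import Data.List.Membership.Propositional.Properties.WithK using (unique∧set⇒bag)
open import Data.List.Membership.DecPropositional _≟_ using (_∈?_; _∉?_)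
open import Data.List.Relation.Unary.All using (All; []; _∷_)
import Data.List.Relation.Unary.All as All
import Data.List.Relation.Unary.All.Properties as All
open import Data.List.Relation.Unary.Any using (here; there)
import Data.List.Relation.Unary.Any.Properties as Any
open import Data.List.Relation.Unary.AllPairs using ([]; _∷_)
open import Data.List.Relation.Unary.Linked using (Linked; []; [-]; _∷_)
import Data.List.Relation.Unary.Linked as Linked
open import Data.List.Relation.Unary.Unique.Propositional using (Unique)
import Data.List.Relation.Unary.Unique.Propositional.Properties as Unique
open import Data.List.Relation.Binary.Disjoint.Propositional using (Disjoint)
open import Data.List.Relation.Binary.Permutation.Propositional
  using (_↭_; prep; ↭-refl; ↭-sym; ↭-trans; ↭⇒↭ₛ; module PermutationReasoning)
open import Data.List.Relation.Binary.Permutation.Propositional.Properties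
  using (All-resp-↭; Any-resp-↭; ↭-length; ↭-empty-inv; ∷↭∷ʳ; ++⁺ˡ; ++⁺ʳ; shift; drop-∷)
open import Data.List.Relation.Binary.Permutation.Setoid.Properties (setoid ℕ) using (Unique-resp-↭)
open import Data.List.Relation.Binary.BagAndSetEquality using (∼bag⇒↭)
open import Function.Base using (_∘_; const)
open import Function.Bundles using (_⇔_; Equivalence; mk⇔)
open import Function.Definitions using (Injective)
open import Relation.Nullary using (yes; no)

-- Unimodal lists

data IsUnimodal : List ℕ → Set where
  decreasing : ∀ {xs} → Linked _>_ xs → IsUnimodal xs
  rising     : ∀ {x y xs} → x < y → IsUnimodal (y ∷ xs) → IsUnimodal (x ∷ y ∷ xs)

Linked-take1 : ∀ {R : ℕ → ℕ → Set} xs → Linked R (take 1 xs)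
Linked-take1 []      = []
Linked-take1 (x ∷ _) = [-]

Unimodal⇒IsUnimodal : ∀ xs → Unimodal xs → IsUnimodal xs
Unimodal⇒IsUnimodal xs          (zero  , _ , dec)         = decreasing dec
Unimodal⇒IsUnimodal []          (suc i , _ , _)           = decreasing []
Unimodal⇒IsUnimodal (x ∷ [])    (suc i , _ , _)           = decreasing [-]
Unimodal⇒IsUnimodal (x ∷ y ∷ r) (suc i , x<y ∷ inc , dec) =
  rising x<y (Unimodal⇒IsUnimodal (y ∷ r) (i , inc , dec))

IsUnimodal⇒Unimodal : ∀ {xs} → IsUnimodal xs → Unimodal xs
IsUnimodal⇒Unimodal {xs} (decreasing dec) = zero , Linked-take1 xs , dec
IsUnimodal⇒Unimodal (rising x<y u) with i , inc , dec ← IsUnimodal⇒Unimodal u =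
  suc i , x<y ∷ inc , dec

Linked->-∷ʳ : ∀ {a} xs → All (a <_) xs → Linked _>_ xs → Linked _>_ (xs ∷ʳ a)
Linked->-∷ʳ []          _            _         = [-]
Linked->-∷ʳ (x ∷ [])    (a<x ∷ _)    _         = a<x ∷ [-]
Linked->-∷ʳ (x ∷ y ∷ r) (_ ∷ a<y∷r)  (y<x ∷ l) = y<x ∷ Linked->-∷ʳ (y ∷ r) a<y∷r l

Linked->-init : ∀ {a} xs → Linked _>_ (xs ∷ʳ a) → Linked _>_ xs
Linked->-init []          _         = []
Linked->-init (x ∷ [])    _         = [-]
Linked->-init (x ∷ y ∷ r) (y<x ∷ l) = y<x ∷ Linked->-init (y ∷ r) l

IsUnimodal-∷ : ∀ {a ys} → All (a <_) ys → IsUnimodal ys → IsUnimodal (a ∷ ys)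
IsUnimodal-∷ {ys = []}    _         _ = decreasing [-]
IsUnimodal-∷ {ys = _ ∷ _} (a<y ∷ _) u = rising a<y u

IsUnimodal-∷ʳ : ∀ {a ys} → All (a <_) ys → IsUnimodal ys → IsUnimodal (ys ∷ʳ a)
IsUnimodal-∷ʳ {ys = ys} a<ys       (decreasing dec) = decreasing (Linked->-∷ʳ ys a<ys dec)
IsUnimodal-∷ʳ           (_ ∷ a<ys) (rising x<y u)   = rising x<y (IsUnimodal-∷ʳ a<ys u)

IsUnimodal-tail : ∀ {a ys} → IsUnimodal (a ∷ ys) → IsUnimodal ys
IsUnimodal-tail (decreasing dec) = decreasing (Linked.tail dec)
IsUnimodal-tail (rising _ u)     = u

IsUnimodal-init : ∀ {a} ys → IsUnimodal (ys ∷ʳ a) → IsUnimodal ys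
IsUnimodal-init []          _                = decreasing []
IsUnimodal-init (x ∷ [])    _                = decreasing [-]
IsUnimodal-init (x ∷ y ∷ r) (decreasing dec) = decreasing (Linked->-init (x ∷ y ∷ r) dec)
IsUnimodal-init (x ∷ y ∷ r) (rising x<y u)   = rising x<y (IsUnimodal-init (y ∷ r) u)

IsUnimodal-minimum-at-end : ∀ {a} ys → IsUnimodal ys → a ∈ ys → All (a ≤_) ys →
  (∃ λ zs → ys ≡ a ∷ zs) ⊎ (∃₂ λ z zs → ys ≡ (z ∷ zs) ∷ʳ a)
IsUnimodal-minimum-at-end (x ∷ r) _ (here refl) _ = inj₁ (r , refl)
IsUnimodal-minimum-at-end (x ∷ r) (decreasing dec) (there a∈r) (_ ∷ a≤r)
  with IsUnimodal-minimum-at-end r (decreasing (Linked.tail dec)) a∈r a≤r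
... | inj₁ ([] , refl)     = inj₂ (x , [] , refl)
... | inj₁ (_ ∷ _ , refl)  =
  ⊥-elim (<⇒≱ (Linked.head (Linked.tail dec)) (All.head (All.tail a≤r)))
... | inj₂ (z , zs , refl) = inj₂ (x , z ∷ zs , refl)
IsUnimodal-minimum-at-end (x ∷ y ∷ r) (rising x<y u) (there a∈r) (a≤x ∷ a≤r)
  with IsUnimodal-minimum-at-end (y ∷ r) u a∈r a≤r
... | inj₁ (_ , refl)      = ⊥-elim (<⇒≱ x<y a≤x)
... | inj₂ (z , zs , eq)   = inj₂ (x , z ∷ zs , cong (x ∷_) eq)

-- Descents

des : List ℕ → ℕ
des xs = length (Des xs)

<ᵇ≡false : ∀ {m n} → n ≤ m → (m <ᵇ n) ≡ false
<ᵇ≡false {m} {n} n≤m with m <ᵇ n in eq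
... | true  = ⊥-elim (≤⇒≯ n≤m (<ᵇ⇒< m n (subst T (sym eq) _)))
... | false = refl

<ᵇ≡true : ∀ {m n} → m < n → (m <ᵇ n) ≡ true
<ᵇ≡true m<n = Equivalence.to T-≡ (<⇒<ᵇ m<n)

des-∷∷ : ∀ x y r → des (x ∷ y ∷ r) ≡ (if y <ᵇ x then 1 else 0) + des (y ∷ r)
des-∷∷ x y r with y <ᵇ x
... | true  = cong suc (length-map suc (Des (y ∷ r)))
... | false = length-map suc (Des (y ∷ r))

des-∷-min : ∀ {a} ys → All (a <_) ys → des (a ∷ ys) ≡ des ys
des-∷-min []      _         = refl
des-∷-min (y ∷ r) (a<y ∷ _) rewrite <ᵇ≡false (<⇒≤ a<y) = length-map suc (Des (y ∷ r))

des-∷ʳ-min : ∀ {a} y r → All (a <_) (y ∷ r) → des ((y ∷ r) ∷ʳ a) ≡ suc (des (y ∷ r))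
des-∷ʳ-min y []        (a<y ∷ _) rewrite <ᵇ≡true a<y = refl
des-∷ʳ-min {a} y (y′ ∷ r) (_ ∷ a<y′∷r) = begin
  des (y ∷ y′ ∷ r ∷ʳ a)                 ≡⟨ des-∷∷ y y′ (r ∷ʳ a) ⟩
  step + des ((y′ ∷ r) ∷ʳ a)            ≡⟨ cong (step +_) (des-∷ʳ-min y′ r a<y′∷r) ⟩
  step + suc (des (y′ ∷ r))             ≡⟨ +-suc step _ ⟩
  suc (step + des (y′ ∷ r))             ≡⟨ cong suc (des-∷∷ y y′ r) ⟨
  suc (des (y ∷ y′ ∷ r))                ∎
  where
  open ≡-Reasoning
  step = if y′ <ᵇ y then 1 else 0

map-suc-++-shift : ∀ L (D J E : List ℕ) →
  map suc (D ++ J ++ map (L +_) E) ≡ map suc D ++ map suc J ++ map (suc L +_) E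
map-suc-++-shift L D J E = begin
  map suc (D ++ J ++ map (L +_) E)                 ≡⟨ map-++ suc D _ ⟩
  map suc D ++ map suc (J ++ map (L +_) E)         ≡⟨ cong (map suc D ++_) (map-++ suc J _) ⟩
  map suc D ++ map suc J ++ map suc (map (L +_) E) ≡⟨ cong ((map suc D ++_) ∘ (map suc J ++_)) (map-∘ E) ⟨
  map suc D ++ map suc J ++ map (suc L +_) E       ∎
  where open ≡-Reasoning

Des-++ : ∀ y r z t → ∃ λ J → All (_≡ suc (length r)) J ×
  Des ((y ∷ r) ++ z ∷ t) ≡ Des (y ∷ r) ++ J ++ map (suc (length r) +_) (Des (z ∷ t))
Des-++ y []       z t with z <ᵇ y
... | true  = 1 ∷ [] , refl ∷ [] , refl
... | false = [] , [] , refl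
Des-++ y (y′ ∷ r) z t with J , J≡ , eq ← Des-++ y′ r z t with y′ <ᵇ y
... | true  = map suc J , All.map⁺ (All.map (cong suc) J≡) , cong (1 ∷_) shifted
  where shifted = trans (cong (map suc) eq) (map-suc-++-shift _ (Des (y′ ∷ r)) J _)
... | false = map suc J , All.map⁺ (All.map (cong suc) J≡) , shifted
  where shifted = trans (cong (map suc) eq) (map-suc-++-shift _ (Des (y′ ∷ r)) J _)

-- desλ λs π unfolds to countOutside (boundaries λs) (Des (entries π)).
countOutside : List ℕ → List ℕ → ℕ
countOutside B xs = length (filter (_∉? B) xs)

countOutside-++ : ∀ B xs ys → countOutside B (xs ++ ys) ≡ countOutside B xs + countOutside B ys
countOutside-++ B xs ys =
  trans (cong length (filter-++ (_∉? B) xs ys)) (length-++ (filter (_∉? B) xs))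

countOutside-outside : ∀ {B xs} → All (_∉ B) xs → countOutside B xs ≡ length xs
countOutside-outside             []            = refl
countOutside-outside {B} {x ∷ _} (x∉B ∷ xs∉B) =
  trans (cong length (filter-accept (_∉? B) {x} x∉B)) (cong suc (countOutside-outside xs∉B))

countOutside-inside : ∀ {B xs} → All (_∈ B) xs → countOutside B xs ≡ 0
countOutside-inside             []            = refl
countOutside-inside {B} {x ∷ _} (x∈B ∷ xs∈B) =
  trans (cong length (filter-reject (_∉? B) {x} (λ x∉B → x∉B x∈B))) (countOutside-inside xs∈B)

countOutside-shift : ∀ l B {D} → All (0 <_) D →
  countOutside (l ∷ map (l +_) B) (map (l +_) D) ≡ countOutside B D
countOutside-shift l B []                   = refl
countOutside-shift l B {p ∷ _} (0<p ∷ 0<D) with p ∈? B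
... | yes p∈B = trans (cong length (filter-reject (_∉? (l ∷ map (l +_) B)) {l + p} (λ l+p∉ → l+p∉ l+p∈)))
                      (countOutside-shift l B 0<D)
  where l+p∈ = there (∈-map⁺ (l +_) p∈B)
... | no p∉B  = trans (cong length (filter-accept (_∉? (l ∷ map (l +_) B)) {l + p} l+p∉))
                      (cong suc (countOutside-shift l B 0<D))
  where
  l+p∉ : l + p ∉ l ∷ map (l +_) B
  l+p∉ (here l+p≡l)  = <-irrefl (sym l+p≡l) (m<m+n l 0<p)
  l+p∉ (there l+p∈) with q , q∈B , l+p≡l+q ← ∈-map⁻ (l +_) l+p∈ =
    p∉B (subst (_∈ B) (sym (+-cancelˡ-≡ l p q l+p≡l+q)) q∈B)

<⇒∉-shifted : ∀ {l p} B → p < l → p ∉ l ∷ map (l +_) B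
<⇒∉-shifted B p<l (here p≡l)  = <-irrefl p≡l p<l
<⇒∉-shifted B p<l (there p∈) with q , _ , p≡l+q ← ∈-map⁻ _ p∈ =
  <⇒≱ p<l (subst (_ ≤_) (sym p≡l+q) (m≤m+n _ q))

bounded-map-suc : ∀ {n ds} → All (λ p → 0 < p × p < n) ds →
  All (λ p → 0 < p × p < suc n) (map suc ds)
bounded-map-suc bs = All.map⁺ (All.map (λ (_ , p<n) → z<s , s<s p<n) bs)

Des-bounded : ∀ xs → All (λ p → 0 < p × p < length xs) (Des xs)
Des-bounded []          = []
Des-bounded (x ∷ [])    = []
Des-bounded (x ∷ y ∷ r) with bounded ← bounded-map-suc (Des-bounded (y ∷ r)) | y <ᵇ x
... | true  = (z<s , s<s z<s) ∷ bounded
... | false = bounded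

Blocks : Set
Blocks = List (List ℕ)

-- The descents of the first block lie below its length L, the descent at the junction (if any)
-- is the boundary L itself, and the remaining ones are those of the later blocks shifted by L.
countOutside-boundaries : ∀ (xss : Blocks) → All (0 <_) (map length xss) →
  countOutside (boundaries (map length xss)) (Des (concat xss)) ≡ sum (map des xss)
countOutside-boundaries [] _ = refl
countOutside-boundaries (ys ∷ []) _ = begin
  countOutside [] (Des (ys ++ []))  ≡⟨ countOutside-outside {xs = Des (ys ++ [])} (All.tabulate λ _ ()) ⟩
  des (ys ++ [])                    ≡⟨ cong des (++-identityʳ ys) ⟩
  des ys                            ≡⟨ +-identityʳ (des ys) ⟨
  des ys + 0                        ∎
  where open ≡-Reasoning
countOutside-boundaries ([] ∷ _ ∷ _) (() ∷ _)
countOutside-boundaries (_ ∷ [] ∷ _) (_ ∷ () ∷ _)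
countOutside-boundaries ((y ∷ r) ∷ (z ∷ t) ∷ rest) (_ ∷ 0<rest)
  with J , J≡L , Des≡ ← Des-++ y r z (t ++ concat rest) = begin
  countOutside B (Des ((y ∷ r) ++ z ∷ t ++ concat rest))
    ≡⟨ cong (countOutside B) Des≡ ⟩
  countOutside B (Des (y ∷ r) ++ J ++ map (L +_) Dz)
    ≡⟨ countOutside-++ B (Des (y ∷ r)) _ ⟩
  countOutside B (Des (y ∷ r)) + countOutside B (J ++ map (L +_) Dz)
    ≡⟨ cong (countOutside B (Des (y ∷ r)) +_) (countOutside-++ B J _) ⟩
  countOutside B (Des (y ∷ r)) + (countOutside B J + countOutside B (map (L +_) Dz))
    ≡⟨ cong₂ (λ u v → u + (v + countOutside B (map (L +_) Dz))) first-block junction ⟩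
  des (y ∷ r) + countOutside B (map (L +_) Dz)
    ≡⟨ cong (des (y ∷ r) +_) (countOutside-shift L B′ (All.map proj₁ (Des-bounded (z ∷ t′)))) ⟩
  des (y ∷ r) + countOutside B′ Dz
    ≡⟨ cong (des (y ∷ r) +_) (countOutside-boundaries ((z ∷ t) ∷ rest) 0<rest) ⟩
  des (y ∷ r) + sum (map des ((z ∷ t) ∷ rest))
    ∎
  where
  open ≡-Reasoning
  L  = suc (length r)
  B′ = boundaries (map length ((z ∷ t) ∷ rest))
  B  = L ∷ map (L +_) B′
  t′ = t ++ concat rest
  Dz = Des (z ∷ t′)
  first-block : countOutside B (Des (y ∷ r)) ≡ des (y ∷ r)
  first-block =
    countOutside-outside (All.map (λ (_ , p<L) → <⇒∉-shifted B′ p<L) (Des-bounded (y ∷ r)))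
  junction : countOutside B J ≡ 0
  junction = countOutside-inside (All.map (λ { refl → here refl }) J≡L)

-- Segments and permutations

take-length-++ : ∀ {A : Set} (ys zs : List A) → take (length ys) (ys ++ zs) ≡ ys
take-length-++ []       zs = refl
take-length-++ (y ∷ ys) zs = cong (y ∷_) (take-length-++ ys zs)

drop-length-++ : ∀ {A : Set} (ys zs : List A) → drop (length ys) (ys ++ zs) ≡ zs
drop-length-++ []       zs = refl
drop-length-++ (y ∷ ys) zs = drop-length-++ ys zs

segments-concat : ∀ (xss : Blocks) → segments (map length xss) (concat xss) ≡ xss
segments-concat []         = refl
segments-concat (ys ∷ xss) = cong₂ _∷_ (take-length-++ ys (concat xss))
  (trans (cong (segments (map length xss)) (drop-length-++ ys (concat xss))) (segments-concat xss))

length-drop-+ : ∀ {A : Set} c s (xs : List A) → length xs ≡ c + s → length (drop c xs) ≡ s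
length-drop-+ c s xs len≡ = trans (length-drop c xs) (trans (cong (_∸ c) len≡) (m+n∸m≡n c s))

map-length-segments : ∀ cs (xs : List ℕ) → length xs ≡ sum cs → map length (segments cs xs) ≡ cs
map-length-segments []       xs _    = refl
map-length-segments (c ∷ cs) xs len≡ = cong₂ _∷_
  (trans (length-take c xs) (m≤n⇒m⊓n≡m (subst (c ≤_) (sym len≡) (m≤m+n c (sum cs)))))
  (map-length-segments cs (drop c xs) (length-drop-+ c (sum cs) xs len≡))

concat-segments : ∀ cs (xs : List ℕ) → length xs ≡ sum cs → concat (segments cs xs) ≡ xs
concat-segments []       []       _    = refl
concat-segments (c ∷ cs) xs       len≡ = trans
  (cong (take c xs ++_) (concat-segments cs (drop c xs) (length-drop-+ c (sum cs) xs len≡)))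
  (take++drop≡id c xs)

range : ℕ → ℕ → List ℕ
range a zero    = []
range a (suc N) = a ∷ range (suc a) N

length-range : ∀ a N → length (range a N) ≡ N
length-range a zero    = refl
length-range a (suc N) = cong suc (length-range (suc a) N)

range-lower : ∀ a N → All (a ≤_) (range a N)
range-lower a zero    = []
range-lower a (suc N) = ≤-refl ∷ All.map (≤-trans (n≤1+n a)) (range-lower (suc a) N)

range-upper : ∀ a N → All (_< a + N) (range a N)
range-upper a zero    = []
range-upper a (suc N) =
  m<m+n a z<s ∷ subst (λ b → All (_< b) (range (suc a) N)) (sym (+-suc a N)) (range-upper (suc a) N)

∈-range : ∀ a N {v} → a ≤ v → v < a + N → v ∈ range a N
∈-range a zero    a≤v v<a+0 = ⊥-elim (<⇒≱ (subst (_ <_) (+-identityʳ a) v<a+0) a≤v)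
∈-range a (suc N) {v} a≤v v<a+N with a ≟ v
... | yes refl = here refl
... | no a≢v   = there (∈-range (suc a) N (≤∧≢⇒< a≤v a≢v) (subst (v <_) (+-suc a N) v<a+N))

range-unique : ∀ a N → Unique (range a N)
range-unique a zero    = []
range-unique a (suc N) = All.map <⇒≢ (range-lower (suc a) N) ∷ range-unique (suc a) N

Fin-injective⇒surjective : ∀ {n} {f : Fin n → Fin n} → Injective _≡_ _≡_ f → ∀ y → ∃ λ i → f i ≡ y
Fin-injective⇒surjective {suc n} {f} f-inj y with any? (λ i → f i ≟ᶠ y)
... | yes hit  = hit
... | no  miss = ⊥-elim (<-irrefl refl (injective⇒≤ g-inj))
  where
  y≢f : ∀ i → y ≢ f i
  y≢f i y≡fi = miss (i , sym y≡fi)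
  g : Fin (suc n) → Fin n
  g i = punchOut (y≢f i)
  g-inj : Injective _≡_ _≡_ g
  g-inj {i} {j} gi≡gj = f-inj (punchOut-injective (y≢f i) (y≢f j) gi≡gj)

Unique-tabulate⇒injective : ∀ {A : Set} {n} {f : Fin n → A} → Unique (tabulate f) → Injective _≡_ _≡_ f
Unique-tabulate⇒injective             (_ ∷ _)    {zero}  {zero}  _ = refl
Unique-tabulate⇒injective             (f₀∉ ∷ _)  {zero}  {suc j} e =
  ⊥-elim (All.lookup f₀∉ (Any.tabulate⁺ j refl) e)
Unique-tabulate⇒injective             (f₀∉ ∷ _)  {suc i} {zero}  e =
  ⊥-elim (All.lookup f₀∉ (Any.tabulate⁺ i refl) (sym e))
Unique-tabulate⇒injective {n = suc _} (_ ∷ uniq) {suc i} {suc j} e = cong suc (Unique-tabulate⇒injective uniq e)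

toList-lookup : ∀ {A : Set} {m} (v : Vec A m) → toList v ≡ tabulate (lookup v)
toList-lookup []      = refl
toList-lookup (x ∷ v) = cong (x ∷_) (toList-lookup v)

entries-tabulate : ∀ {n} (π : Word n) → entries π ≡ tabulate (toℕ ∘ lookup π)
entries-tabulate π = trans (cong (map toℕ) (toList-lookup π)) (map-tabulate (lookup π) toℕ)

entries-< : ∀ {n} (π : Word n) → All (_< n) (entries π)
entries-< π = subst (All (_< _)) (sym (entries-tabulate π)) (All.tabulate⁺ (toℕ<n ∘ lookup π))

length-entries : ∀ {n} (π : Word n) → length (entries π) ≡ n
length-entries π = trans (length-map toℕ (toList π)) (length-toList π)

entries-injective : ∀ {n} {π σ : Word n} → entries π ≡ entries σ → π ≡ σ
entries-injective {π = π} {σ} e =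
  trans (sym (cast-is-id refl π)) (toList-injective refl π σ (map-injective toℕ-injective e))

IsPerm⇒entries↭range : ∀ {n} (π : Word n) → IsPerm π → entries π ↭ range 0 n
IsPerm⇒entries↭range {n} π π-inj =
  ∼bag⇒↭ (unique∧set⇒bag entries-unique (range-unique 0 n) (mk⇔ to from))
  where
  entries-unique : Unique (entries π)
  entries-unique =
    subst Unique (sym (entries-tabulate π)) (Unique.tabulate⁺ (π-inj ∘ toℕ-injective))
  to : ∀ {v} → v ∈ entries π → v ∈ range 0 n
  to v∈ = ∈-range 0 n z≤n (All.lookup (entries-< π) v∈)
  from : ∀ {v} → v ∈ range 0 n → v ∈ entries π
  from {v} v∈ = subst (v ∈_) (sym (entries-tabulate π))
    (Any.tabulate⁺ (proj₁ hit) (sym (trans (cong toℕ (proj₂ hit)) (toℕ-fromℕ< v<n))))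
    where
    v<n = All.lookup (range-upper 0 n) v∈
    hit = Fin-injective⇒surjective π-inj (fromℕ< v<n)

entries↭range⇒IsPerm : ∀ {n} (π : Word n) → entries π ↭ range 0 n → IsPerm π
entries↭range⇒IsPerm {n} π π↭ = toℕ∘π-injective ∘ cong toℕ
  where
  toℕ∘π-injective : Injective _≡_ _≡_ (toℕ ∘ lookup π)
  toℕ∘π-injective = Unique-tabulate⇒injective
    (subst Unique (entries-tabulate π) (Unique-resp-↭ (↭⇒↭ₛ (↭-sym π↭)) (range-unique 0 n)))

-- Fillings and their generation by inserting the minimum

All-mid : ∀ {A : Set} {P : A → Set} (X1 : List A) {ys} X2 → All P (X1 ++ ys ∷ X2) → P ys
All-mid X1 X2 all = All.head (All.++⁻ʳ X1 all)

All-concat-mid : ∀ {A : Set} {P : A → Set} (X1 : List (List A)) ys X2 → All P (concat (X1 ++ ys ∷ X2)) → All P ys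
All-concat-mid X1 ys X2 all =
  All.++⁻ˡ ys (All.++⁻ʳ (concat X1) (subst (All _) (sym (concat-++ X1 (ys ∷ X2))) all))

split-shape : ∀ (xss : Blocks) pre {c post} → map length xss ≡ pre ++ c ∷ post →
  ∃₂ λ X1 ys → ∃ λ X2 → xss ≡ X1 ++ ys ∷ X2
                      × map length X1 ≡ pre × length ys ≡ c × map length X2 ≡ post
split-shape (ys ∷ xss) []      refl = [] , ys , xss , refl , refl , refl , refl
split-shape (ys ∷ xss) (p ∷ pre) shape≡
  with refl , shape′ ← ∷-injective shape≡
  with X1 , zs , X2 , refl , refl , refl , refl ← split-shape xss pre shape′ =
  ys ∷ X1 , zs , X2 , refl , refl , refl , refl

length-shape : ∀ (xss : Blocks) pre {c post} → map length xss ≡ pre ++ c ∷ post → length pre < length xss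
length-shape xss pre {c} {post} shape≡ = begin-strict
  length pre                      <⟨ m<m+n (length pre) z<s ⟩
  length pre + length (c ∷ post)  ≡⟨ length-++ pre ⟨
  length (pre ++ c ∷ post)        ≡⟨ cong length shape≡ ⟨
  length (map length xss)         ≡⟨ length-map length xss ⟩
  length xss                      ∎
  where open ≤-Reasoning

All-replace : ∀ {A : Set} {P : A → Set} (X1 : List A) {ys ys′} X2 →
  All P (X1 ++ ys ∷ X2) → P ys′ → All P (X1 ++ ys′ ∷ X2)
All-replace X1 X2 all p with all₁ , _ ∷ all₂ ← All.++⁻ X1 all = All.++⁺ all₁ (p ∷ all₂)

record Filling (a N : ℕ) (cs : List ℕ) (d : ℕ) (xss : Blocks) : Set where
  constructor filling
  field
    shape    : map length xss ≡ cs
    unimodal : All IsUnimodal xss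
    values   : concat xss ↭ range a N
    descents : sum (map des xss) ≡ d

Filling-above : ∀ {a N cs d xss} → Filling (suc a) N cs d xss → All (a <_) (concat xss)
Filling-above {a} {N} (filling _ _ vals _) = All-resp-↭ (↭-sym vals) (range-lower (suc a) N)

Filling-∉ : ∀ {a N cs d xss} → Filling (suc a) N cs d xss → a ∉ concat xss
Filling-∉ F a∈ = <-irrefl refl (All.lookup (Filling-above F) a∈)

concat-replace-↭ : ∀ {A : Set} {a : A} (X1 : List (List A)) {ys ys′} X2 → ys′ ↭ a ∷ ys →
  concat (X1 ++ ys′ ∷ X2) ↭ a ∷ concat (X1 ++ ys ∷ X2)
concat-replace-↭ {a = a} X1 {ys} {ys′} X2 ys′↭ = begin
  concat (X1 ++ ys′ ∷ X2)            ≡⟨ concat-++ X1 (ys′ ∷ X2) ⟨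
  concat X1 ++ ys′ ++ concat X2      ↭⟨ ++⁺ˡ (concat X1) (++⁺ʳ (concat X2) ys′↭) ⟩
  concat X1 ++ (a ∷ ys) ++ concat X2 ↭⟨ shift a (concat X1) (ys ++ concat X2) ⟩
  a ∷ concat X1 ++ ys ++ concat X2   ≡⟨ cong (a ∷_) (concat-++ X1 (ys ∷ X2)) ⟩
  a ∷ concat (X1 ++ ys ∷ X2)         ∎
  where open PermutationReasoning

sum-des-replace : ∀ {k} (X1 : Blocks) {ys ys′} X2 → des ys′ ≡ k + des ys →
  sum (map des (X1 ++ ys′ ∷ X2)) ≡ k + sum (map des (X1 ++ ys ∷ X2))
sum-des-replace {k} X1 {ys} {ys′} X2 des≡ = begin
  sum (map des (X1 ++ ys′ ∷ X2))    ≡⟨ sum-map-mid ys′ ⟩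
  S₁ + (des ys′ + S₂)               ≡⟨ cong (λ n → S₁ + (n + S₂)) des≡ ⟩
  S₁ + (k + des ys + S₂)            ≡⟨ cong (S₁ +_) (+-assoc k (des ys) S₂) ⟩
  S₁ + (k + (des ys + S₂))          ≡⟨ +-left-comm S₁ k (des ys + S₂) ⟩
  k + (S₁ + (des ys + S₂))          ≡⟨ cong (k +_) (sum-map-mid ys) ⟨
  k + sum (map des (X1 ++ ys ∷ X2)) ∎
  where
  open ≡-Reasoning
  S₁ = sum (map des X1)
  S₂ = sum (map des X2)
  sum-map-mid : ∀ zs → sum (map des (X1 ++ zs ∷ X2)) ≡ S₁ + (des zs + S₂)
  sum-map-mid zs = trans (cong sum (map-++ des X1 (zs ∷ X2))) (sum-++ (map des X1) _)

Filling-insert : ∀ {a N cs d k} X1 {ys ys′} X2 → Filling (suc a) N cs d (X1 ++ ys ∷ X2) →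
  IsUnimodal ys′ → ys′ ↭ a ∷ ys → des ys′ ≡ k + des ys →
  Filling a (suc N) (map length X1 ++ suc (length ys) ∷ map length X2) (k + d) (X1 ++ ys′ ∷ X2)
Filling-insert {a} X1 {ys′ = ys′} X2 (filling _ um vals refl) um′ ys′↭ des≡ = filling
  (trans (map-++ length X1 (ys′ ∷ X2))
    (cong (λ l → map length X1 ++ l ∷ map length X2) (↭-length ys′↭)))
  (All-replace X1 X2 um um′)
  (↭-trans (concat-replace-↭ X1 X2 ys′↭) (prep a vals))
  (sum-des-replace X1 X2 des≡)

Filling-remove : ∀ {a N cs d} X1 {ys ys′} X2 → Filling a (suc N) cs d (X1 ++ ys′ ∷ X2) →
  IsUnimodal ys → ys′ ↭ a ∷ ys →
  Filling (suc a) N (map length X1 ++ length ys ∷ map length X2) (sum (map des (X1 ++ ys ∷ X2))) (X1 ++ ys ∷ X2)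
Filling-remove X1 {ys} X2 (filling _ um vals _) um′ ys′↭ =
  filling (map-++ length X1 (ys ∷ X2)) (All-replace X1 X2 um um′)
    (drop-∷ (↭-trans (↭-sym (concat-replace-↭ X1 X2 ys′↭)) vals)) refl

modifyAt : ∀ {A : Set} → ℕ → (A → A) → List A → List A
modifyAt _       f []         = []
modifyAt zero    f (ys ∷ yss) = f ys ∷ yss
modifyAt (suc j) f (ys ∷ yss) = ys ∷ modifyAt j f yss

modifyAt-++ : ∀ {A : Set} {j} f (X1 : List A) ys X2 → length X1 ≡ j →
  modifyAt j f (X1 ++ ys ∷ X2) ≡ X1 ++ f ys ∷ X2
modifyAt-++ f []       ys X2 refl = refl
modifyAt-++ f (x ∷ X1) ys X2 refl = cong (x ∷_) (modifyAt-++ f X1 ys X2 refl)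

modifyAt-injective : ∀ {A : Set} j {f : A → A} → Injective _≡_ _≡_ f → Injective _≡_ _≡_ (modifyAt j f)
modifyAt-injective j       f-inj {[]}     {[]}     _ = refl
modifyAt-injective zero    f-inj {_ ∷ _}  {_ ∷ _}  e =
  cong₂ _∷_ (f-inj (∷-injectiveˡ e)) (∷-injectiveʳ e)
modifyAt-injective (suc j) f-inj {_ ∷ _}  {_ ∷ _}  e =
  cong₂ _∷_ (∷-injectiveˡ e) (modifyAt-injective j f-inj (∷-injectiveʳ e))
modifyAt-injective zero    f-inj {[]}     {_ ∷ _}  ()
modifyAt-injective (suc j) f-inj {[]}     {_ ∷ _}  ()
modifyAt-injective zero    f-inj {_ ∷ _}  {[]}     ()
modifyAt-injective (suc j) f-inj {_ ∷ _}  {[]}     ()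

sum-mid-suc : ∀ pre c post → sum (pre ++ suc c ∷ post) ≡ suc (sum (pre ++ c ∷ post))
sum-mid-suc pre c post = begin
  sum (pre ++ suc c ∷ post)         ≡⟨ sum-++ pre (suc c ∷ post) ⟩
  sum pre + suc (c + sum post)      ≡⟨ +-suc (sum pre) _ ⟩
  suc (sum pre + (c + sum post))    ≡⟨ cong suc (sum-++ pre (c ∷ post)) ⟨
  suc (sum (pre ++ c ∷ post))       ∎
  where open ≡-Reasoning

length-∷ʳ : ∀ {A : Set} (xs : List A) x → length (xs ∷ʳ x) ≡ suc (length xs)
length-∷ʳ xs x = trans (length-++ xs) (+-comm (length xs) 1)

-- Insertions at different blocks are told apart by the first block containing the new minimum.
firstBlockWith : ℕ → Blocks → ℕ
firstBlockWith v []         = 0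
firstBlockWith v (ys ∷ yss) with v ∈? ys
... | yes _ = 0
... | no  _ = suc (firstBlockWith v yss)

firstBlockWith-modifyAt : ∀ {v f} j yss → (∀ ys → v ∈ f ys) → v ∉ concat yss → j < length yss →
  firstBlockWith v (modifyAt j f yss) ≡ j
firstBlockWith-modifyAt {v} {f} zero    (ys ∷ yss) v∈f _ _ with v ∈? f ys
... | yes _   = refl
... | no  v∉  = ⊥-elim (v∉ (v∈f ys))
firstBlockWith-modifyAt {v}     (suc j) (ys ∷ yss) v∈f v∉ (s<s j<) with v ∈? ys
... | yes v∈ = ⊥-elim (v∉ (∈-++⁺ˡ v∈))
... | no  _  = cong suc (firstBlockWith-modifyAt j yss v∈f (v∉ ∘ ∈-++⁺ʳ ys) j<)

modifyAt-∷≢∷ʳ : ∀ {a e post} pre (yss zss : Blocks) → a ∉ concat zss → map length zss ≡ pre ++ suc e ∷ post →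
  modifyAt (length pre) (a ∷_) yss ≢ modifyAt (length pre) (_∷ʳ a) zss
modifyAt-∷≢∷ʳ []        []         (_ ∷ _)         _  _     ()
modifyAt-∷≢∷ʳ []        (ys ∷ yss) ((z ∷ r) ∷ zss) a∉ _     eq =
  a∉ (here (∷-injectiveˡ (∷-injectiveˡ eq)))
modifyAt-∷≢∷ʳ (_ ∷ pre) []         (_ ∷ _)         _  _     ()
modifyAt-∷≢∷ʳ (_ ∷ pre) (ys ∷ yss) (zs ∷ zss)      a∉ shape eq =
  modifyAt-∷≢∷ʳ pre yss zss (a∉ ∘ ∈-++⁺ʳ zs) (∷-injectiveʳ shape) (∷-injectiveʳ eq)

countNonzero : List ℕ → ℕ
countNonzero []           = 0
countNonzero (zero ∷ cs)  = countNonzero cs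
countNonzero (suc _ ∷ cs) = suc (countNonzero cs)

countNonzero-++ : ∀ xs ys → countNonzero (xs ++ ys) ≡ countNonzero xs + countNonzero ys
countNonzero-++ []           ys = refl
countNonzero-++ (zero ∷ xs)  ys = countNonzero-++ xs ys
countNonzero-++ (suc _ ∷ xs) ys = cong suc (countNonzero-++ xs ys)

countNonzero≤sum : ∀ cs → countNonzero cs ≤ sum cs
countNonzero≤sum []           = z≤n
countNonzero≤sum (zero ∷ cs)  = countNonzero≤sum cs
countNonzero≤sum (suc c ∷ cs) = s≤s (≤-trans (countNonzero≤sum cs) (m≤n+m (sum cs) c))

countNonzero-positive : ∀ {cs} → All (0 <_) cs → countNonzero cs ≡ length cs
countNonzero-positive []                 = refl
countNonzero-positive (s≤s _ ∷ positive) = cong suc (countNonzero-positive positive)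

prodFact-mid : ∀ pre c post → prodFact (pre ++ c ∷ post) ≡ prodFact pre * (c ! * prodFact post)
prodFact-mid pre c post = trans (cong product (map-++ _! pre (c ∷ post))) (product-++ (map _! pre) _)

Generator : Set
Generator = List ℕ → ℕ → List Blocks

module Insertion (G : Generator) (a : ℕ) where

  front : List ℕ → ℕ → List ℕ → ℕ → List Blocks
  front pre c post d = map (modifyAt (length pre) (a ∷_)) (G (pre ++ c ∷ post) d)

  back : List ℕ → ℕ → List ℕ → ℕ → List Blocks
  back pre c post d = map (modifyAt (length pre) (_∷ʳ a)) (G (pre ++ c ∷ post) d)

  placeIn : List ℕ → ℕ → List ℕ → ℕ → List Blocks
  placeIn pre zero          post d       = []
  placeIn pre (suc zero)    post d       = front pre zero post d
  placeIn pre (suc (suc c)) post zero    = front pre (suc c) post zero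
  placeIn pre (suc (suc c)) post (suc d) = front pre (suc c) post (suc d) ++ back pre (suc c) post d

  placeAnywhere : List ℕ → List ℕ → ℕ → List Blocks
  placeAnywhere pre []         d = []
  placeAnywhere pre (c ∷ post) d = placeIn pre c post d ++ placeAnywhere (pre ∷ʳ c) post d

  data Placed (pre : List ℕ) : ℕ → List ℕ → ℕ → Blocks → Set where
    at-front : ∀ {c post d yss} → yss ∈ G (pre ++ c ∷ post) d →
               Placed pre (suc c) post d (modifyAt (length pre) (a ∷_) yss)
    at-back  : ∀ {c post d yss} → yss ∈ G (pre ++ suc c ∷ post) d →
               Placed pre (suc (suc c)) post (suc d) (modifyAt (length pre) (_∷ʳ a) yss)

  front-placed : ∀ {pre c post d x} → x ∈ front pre c post d → Placed pre (suc c) post d x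
  front-placed x∈ with _ , yss∈ , refl ← ∈-map⁻ _ x∈ = at-front yss∈

  back-placed : ∀ {pre c post d x} → x ∈ back pre (suc c) post d → Placed pre (suc (suc c)) post (suc d) x
  back-placed x∈ with _ , yss∈ , refl ← ∈-map⁻ _ x∈ = at-back yss∈

  placeIn-placed : ∀ pre c post d {x} → x ∈ placeIn pre c post d → Placed pre c post d x
  placeIn-placed pre (suc zero)    post d       = front-placed
  placeIn-placed pre (suc (suc c)) post zero    = front-placed
  placeIn-placed pre (suc (suc c)) post (suc d) x∈ with ∈-++⁻ (front pre (suc c) post (suc d)) x∈
  ... | inj₁ x∈front = front-placed x∈front
  ... | inj₂ x∈back  = back-placed x∈back

  placed-∈-placeIn : ∀ {pre c post d x} → Placed pre c post d x → x ∈ placeIn pre c post d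
  placed-∈-placeIn (at-front {zero}              yss∈) = ∈-map⁺ _ yss∈
  placed-∈-placeIn (at-front {suc _} {d = zero}  yss∈) = ∈-map⁺ _ yss∈
  placed-∈-placeIn (at-front {suc _} {d = suc _} yss∈) = ∈-++⁺ˡ (∈-map⁺ _ yss∈)
  placed-∈-placeIn (at-back                      yss∈) = ∈-++⁺ʳ _ (∈-map⁺ _ yss∈)

  placeIn-⊆-placeAnywhere : ∀ pre mid {c post d x} →
    x ∈ placeIn (pre ++ mid) c post d → x ∈ placeAnywhere pre (mid ++ c ∷ post) d
  placeIn-⊆-placeAnywhere pre []        {c} {post} {d} {x} x∈ =
    ∈-++⁺ˡ (subst (λ p → x ∈ placeIn p c post d) (++-identityʳ pre) x∈)
  placeIn-⊆-placeAnywhere pre (m ∷ mid) {c} {post} {d} {x} x∈ =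
    ∈-++⁺ʳ _ (placeIn-⊆-placeAnywhere (pre ∷ʳ m) mid
      (subst (λ p → x ∈ placeIn p c post d) (sym (∷ʳ-++ pre m mid)) x∈))

  pred-sum : ∀ {N} pre c post → sum (pre ++ suc c ∷ post) ≡ suc N → sum (pre ++ c ∷ post) ≡ N
  pred-sum pre c post s = suc-injective (trans (sym (sum-mid-suc pre c post)) s)

  module _ {N} (G-sound : ∀ {cs d yss} → sum cs ≡ N → yss ∈ G cs d → Filling (suc a) N cs d yss) where

    placed-sound : ∀ {pre c post d x} → sum (pre ++ c ∷ post) ≡ suc N → Placed pre c post d x →
      Filling a (suc N) (pre ++ c ∷ post) d x
    placed-sound {pre} {suc c} {post} s (at-front {yss = yss} yss∈)
      with F ← G-sound (pred-sum pre c post s) yss∈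
      with X1 , ys , X2 , refl , refl , refl , refl ← split-shape yss pre (Filling.shape F) =
      let above = All-concat-mid X1 ys X2 (Filling-above F) in
      subst (Filling a (suc N) _ _) (sym (modifyAt-++ (a ∷_) X1 ys X2 (sym (length-map length X1))))
        (Filling-insert X1 X2 F (IsUnimodal-∷ above (All-mid X1 X2 (Filling.unimodal F)))
          ↭-refl (des-∷-min ys above))
    placed-sound {pre} {suc (suc c)} {post} s (at-back {yss = yss} yss∈)
      with F ← G-sound (pred-sum pre (suc c) post s) yss∈
      with split-shape yss pre (Filling.shape F)
    ... | _  , []    , _  , _    , _    , ()   , _
    ... | X1 , y ∷ r , X2 , refl , refl , refl , refl =
      let above = All-concat-mid X1 (y ∷ r) X2 (Filling-above F) in
      subst (Filling a (suc N) _ _) (sym (modifyAt-++ (_∷ʳ a) X1 (y ∷ r) X2 (sym (length-map length X1))))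
        (Filling-insert X1 X2 F (IsUnimodal-∷ʳ above (All-mid X1 X2 (Filling.unimodal F)))
          (↭-sym (∷↭∷ʳ a (y ∷ r))) (des-∷ʳ-min y r above))

    placeAnywhere-sound : ∀ pre rest {d x} → sum (pre ++ rest) ≡ suc N → x ∈ placeAnywhere pre rest d →
      Filling a (suc N) (pre ++ rest) d x
    placeAnywhere-sound pre (c ∷ post) {d} s x∈ with ∈-++⁻ (placeIn pre c post d) x∈
    ... | inj₁ x∈here  = placed-sound s (placeIn-placed pre c post d x∈here)
    ... | inj₂ x∈later = subst (λ cs → Filling a (suc N) cs _ _) (∷ʳ-++ pre c post)
      (placeAnywhere-sound (pre ∷ʳ c) post (trans (cong sum (∷ʳ-++ pre c post)) s) x∈later)

    placed-firstBlock : ∀ {pre c post d x} → sum (pre ++ c ∷ post) ≡ suc N → Placed pre c post d x →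
      firstBlockWith a x ≡ length pre
    placed-firstBlock {pre} {suc c} {post} s (at-front {yss = yss} yss∈) =
      let F = G-sound (pred-sum pre c post s) yss∈ in
      firstBlockWith-modifyAt (length pre) yss (λ _ → here refl) (Filling-∉ F)
        (length-shape yss pre (Filling.shape F))
    placed-firstBlock {pre} {suc (suc c)} {post} s (at-back {yss = yss} yss∈) =
      let F = G-sound (pred-sum pre (suc c) post s) yss∈ in
      firstBlockWith-modifyAt (length pre) yss (λ ys → ∈-++⁺ʳ ys (here refl)) (Filling-∉ F)
        (length-shape yss pre (Filling.shape F))

    placeAnywhere-firstBlock : ∀ pre rest {d x} → sum (pre ++ rest) ≡ suc N →
      x ∈ placeAnywhere pre rest d → length pre ≤ firstBlockWith a x
    placeAnywhere-firstBlock pre (c ∷ post) {d} s x∈ with ∈-++⁻ (placeIn pre c post d) x∈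
    ... | inj₁ x∈here  = ≤-reflexive (sym (placed-firstBlock s (placeIn-placed pre c post d x∈here)))
    ... | inj₂ x∈later = ≤-trans (≤-trans (n≤1+n (length pre)) (≤-reflexive (sym (length-∷ʳ pre c))))
      (placeAnywhere-firstBlock (pre ∷ʳ c) post (trans (cong sum (∷ʳ-++ pre c post)) s) x∈later)

    module _ (G-unique : ∀ {cs} d → sum cs ≡ N → Unique (G cs d)) where

      front-unique : ∀ pre c post d → sum (pre ++ c ∷ post) ≡ N → Unique (front pre c post d)
      front-unique pre c post d s =
        Unique.map⁺ (modifyAt-injective (length pre) ∷-injectiveʳ) (G-unique d s)

      back-unique : ∀ pre c post d → sum (pre ++ c ∷ post) ≡ N → Unique (back pre c post d)
      back-unique pre c post d s =
        Unique.map⁺ (modifyAt-injective (length pre) (∷ʳ-injectiveˡ _ _)) (G-unique d s)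

      front-back-disjoint : ∀ pre c post d → sum (pre ++ suc c ∷ post) ≡ N →
        Disjoint (front pre (suc c) post (suc d)) (back pre (suc c) post d)
      front-back-disjoint pre c post d s (x∈front , x∈back)
        with _ , _ , refl ← ∈-map⁻ _ x∈front | zss , zss∈ , eq ← ∈-map⁻ _ x∈back =
        let F = G-sound s zss∈ in modifyAt-∷≢∷ʳ pre _ zss (Filling-∉ F) (Filling.shape F) eq

      placeIn-unique : ∀ pre c post d → sum (pre ++ c ∷ post) ≡ suc N → Unique (placeIn pre c post d)
      placeIn-unique pre zero          post d       s = []
      placeIn-unique pre (suc zero)    post d       s = front-unique pre zero post d (pred-sum pre zero post s)
      placeIn-unique pre (suc (suc c)) post zero    s =
        front-unique pre (suc c) post zero (pred-sum pre (suc c) post s)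
      placeIn-unique pre (suc (suc c)) post (suc d) s =
        let s′ = pred-sum pre (suc c) post s in
        Unique.++⁺ (front-unique pre (suc c) post (suc d) s′) (back-unique pre (suc c) post d s′)
          (front-back-disjoint pre c post d s′)

      placeAnywhere-unique : ∀ pre rest d → sum (pre ++ rest) ≡ suc N → Unique (placeAnywhere pre rest d)
      placeAnywhere-unique pre []         d s = []
      placeAnywhere-unique pre (c ∷ post) d s =
        Unique.++⁺ (placeIn-unique pre c post d s) (placeAnywhere-unique (pre ∷ʳ c) post d s′) disjoint
        where
        s′ = trans (cong sum (∷ʳ-++ pre c post)) s
        disjoint : Disjoint (placeIn pre c post d) (placeAnywhere (pre ∷ʳ c) post d)
        disjoint (x∈here , x∈later) = <-irrefl
          (sym (placed-firstBlock s (placeIn-placed pre c post d x∈here)))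
          (subst (_≤ _) (length-∷ʳ pre c) (placeAnywhere-firstBlock (pre ∷ʳ c) post s′ x∈later))

  module _ {N} (G-count : ∀ {cs} d → sum cs ≡ N →
                 length (G cs d) * prodFact cs ≡ N ! * ((N ∸ countNonzero cs) C d)) where

    front-count : ∀ pre c post d → sum (pre ++ c ∷ post) ≡ N →
      length (front pre c post d) * prodFact (pre ++ c ∷ post)
        ≡ N ! * ((N ∸ countNonzero (pre ++ c ∷ post)) C d)
    front-count pre c post d s = trans (cong (_* _) (length-map _ (G _ d))) (G-count d s)

    back-count : ∀ pre c post d → sum (pre ++ c ∷ post) ≡ N →
      length (back pre c post d) * prodFact (pre ++ c ∷ post)
        ≡ N ! * ((N ∸ countNonzero (pre ++ c ∷ post)) C d)
    back-count pre c post d s = trans (cong (_* _) (length-map _ (G _ d))) (G-count d s)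

    front-back-count : ∀ pre c post d → sum (pre ++ suc c ∷ post) ≡ N →
      length (placeIn pre (suc (suc c)) post d) * prodFact (pre ++ suc c ∷ post)
        ≡ N ! * (suc (N ∸ countNonzero (pre ++ suc c ∷ post)) C d)
    front-back-count pre c post zero    s = front-count pre (suc c) post zero s
    front-back-count pre c post (suc d) s = begin
      length (front pre (suc c) post (suc d) ++ back pre (suc c) post d) * pf
        ≡⟨ cong (_* pf) (length-++ (front pre (suc c) post (suc d))) ⟩
      (length (front pre (suc c) post (suc d)) + length (back pre (suc c) post d)) * pf
        ≡⟨ *-distribʳ-+ pf (length (front pre (suc c) post (suc d))) _ ⟩
      length (front pre (suc c) post (suc d)) * pf + length (back pre (suc c) post d) * pf
        ≡⟨ cong₂ _+_ (front-count pre (suc c) post (suc d) s) (back-count pre (suc c) post d s) ⟩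
      N ! * (M C suc d) + N ! * (M C d)
        ≡⟨ *-distribˡ-+ (N !) (M C suc d) (M C d) ⟨
      N ! * (M C suc d + M C d)
        ≡⟨ cong (N ! *_) (trans (+-comm (M C suc d) (M C d)) (nCk+nC[k+1]≡[n+1]C[k+1] M d)) ⟩
      N ! * (suc M C suc d)
        ∎
      where
      open ≡-Reasoning
      pf = prodFact (pre ++ suc c ∷ post)
      M  = N ∸ countNonzero (pre ++ suc c ∷ post)

    placeIn-count-1 : ∀ pre post d → sum (pre ++ 1 ∷ post) ≡ suc N →
      length (placeIn pre 1 post d) * prodFact (pre ++ 1 ∷ post)
        ≡ 1 * (N ! * ((suc N ∸ countNonzero (pre ++ 1 ∷ post)) C d))
    placeIn-count-1 pre post d s = begin
      length (front pre 0 post d) * prodFact (pre ++ 1 ∷ post)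
        ≡⟨ cong (length (front pre 0 post d) *_)
             (trans (prodFact-mid pre 1 post) (sym (prodFact-mid pre 0 post))) ⟩
      length (front pre 0 post d) * prodFact (pre ++ 0 ∷ post)
        ≡⟨ front-count pre 0 post d (pred-sum pre 0 post s) ⟩
      N ! * ((N ∸ countNonzero (pre ++ 0 ∷ post)) C d)
        ≡⟨ cong (λ k → N ! * ((suc N ∸ k) C d)) nonzero≡ ⟨
      N ! * ((suc N ∸ countNonzero (pre ++ 1 ∷ post)) C d)
        ≡⟨ *-identityˡ _ ⟨
      1 * (N ! * ((suc N ∸ countNonzero (pre ++ 1 ∷ post)) C d))
        ∎
      where
      open ≡-Reasoning
      nonzero≡ : countNonzero (pre ++ 1 ∷ post) ≡ suc (countNonzero (pre ++ 0 ∷ post))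
      nonzero≡ = begin
        countNonzero (pre ++ 1 ∷ post)            ≡⟨ countNonzero-++ pre (1 ∷ post) ⟩
        countNonzero pre + suc (countNonzero post) ≡⟨ +-suc (countNonzero pre) _ ⟩
        suc (countNonzero pre + countNonzero post) ≡⟨ cong suc (countNonzero-++ pre (0 ∷ post)) ⟨
        suc (countNonzero (pre ++ 0 ∷ post))       ∎

    placeIn-count-≥2 : ∀ pre c post d → sum (pre ++ suc (suc c) ∷ post) ≡ suc N →
      length (placeIn pre (suc (suc c)) post d) * prodFact (pre ++ suc (suc c) ∷ post)
        ≡ suc (suc c) * (N ! * ((suc N ∸ countNonzero (pre ++ suc (suc c) ∷ post)) C d))
    placeIn-count-≥2 pre c post d s = begin
      length P * prodFact (pre ++ c₂ ∷ post)
        ≡⟨ cong (length P *_) prodFact≡ ⟩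
      length P * (c₂ * prodFact cs′)
        ≡⟨ *-left-comm (length P) c₂ (prodFact cs′) ⟩
      c₂ * (length P * prodFact cs′)
        ≡⟨ cong (c₂ *_) (front-back-count pre c post d s′) ⟩
      c₂ * (N ! * (suc (N ∸ countNonzero cs′) C d))
        ≡⟨ cong (λ k → c₂ * (N ! * (k C d))) (+-∸-assoc 1 nonzero≤N) ⟨
      c₂ * (N ! * ((suc N ∸ countNonzero cs′) C d))
        ≡⟨ cong (λ k → c₂ * (N ! * ((suc N ∸ k) C d))) nonzero≡ ⟨
      c₂ * (N ! * ((suc N ∸ countNonzero (pre ++ c₂ ∷ post)) C d))
        ∎
      where
      open ≡-Reasoning
      c₂  = suc (suc c)
      cs′ = pre ++ suc c ∷ post
      P   = placeIn pre c₂ post d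
      s′  = pred-sum pre (suc c) post s
      prodFact≡ : prodFact (pre ++ c₂ ∷ post) ≡ c₂ * prodFact cs′
      prodFact≡ = begin
        prodFact (pre ++ c₂ ∷ post)                     ≡⟨ prodFact-mid pre c₂ post ⟩
        prodFact pre * (c₂ * suc c ! * prodFact post)   ≡⟨ cong (prodFact pre *_) (*-assoc c₂ (suc c !) _) ⟩
        prodFact pre * (c₂ * (suc c ! * prodFact post)) ≡⟨ *-left-comm (prodFact pre) c₂ _ ⟩
        c₂ * (prodFact pre * (suc c ! * prodFact post)) ≡⟨ cong (c₂ *_) (prodFact-mid pre (suc c) post) ⟨
        c₂ * prodFact cs′                               ∎
      nonzero≤N : countNonzero cs′ ≤ N
      nonzero≤N = subst (countNonzero cs′ ≤_) s′ (countNonzero≤sum cs′)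
      nonzero≡ : countNonzero (pre ++ c₂ ∷ post) ≡ countNonzero cs′
      nonzero≡ = trans (countNonzero-++ pre (c₂ ∷ post)) (sym (countNonzero-++ pre (suc c ∷ post)))

    placeIn-count : ∀ pre c post d → sum (pre ++ c ∷ post) ≡ suc N →
      length (placeIn pre c post d) * prodFact (pre ++ c ∷ post)
        ≡ c * (N ! * ((suc N ∸ countNonzero (pre ++ c ∷ post)) C d))
    placeIn-count pre zero          post d s = refl
    placeIn-count pre (suc zero)    post d s = placeIn-count-1 pre post d s
    placeIn-count pre (suc (suc c)) post d s = placeIn-count-≥2 pre c post d s

    placeAnywhere-count : ∀ {cs} d → sum cs ≡ suc N → ∀ pre rest → pre ++ rest ≡ cs →
      length (placeAnywhere pre rest d) * prodFact cs ≡ sum rest * (N ! * ((suc N ∸ countNonzero cs) C d))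
    placeAnywhere-count d s pre []         _    = refl
    placeAnywhere-count d s pre (c ∷ post) refl = begin
      length (placeIn pre c post d ++ placeAnywhere (pre ∷ʳ c) post d) * pf
        ≡⟨ cong (_* pf) (length-++ (placeIn pre c post d)) ⟩
      (length (placeIn pre c post d) + length (placeAnywhere (pre ∷ʳ c) post d)) * pf
        ≡⟨ *-distribʳ-+ pf (length (placeIn pre c post d)) _ ⟩
      length (placeIn pre c post d) * pf + length (placeAnywhere (pre ∷ʳ c) post d) * pf
        ≡⟨ cong₂ _+_ (placeIn-count pre c post d s)
                     (placeAnywhere-count d s (pre ∷ʳ c) post (∷ʳ-++ pre c post)) ⟩
      c * K + sum post * K
        ≡⟨ *-distribʳ-+ K c (sum post) ⟨
      (c + sum post) * K
        ∎
      where
      open ≡-Reasoning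
      pf = prodFact (pre ++ c ∷ post)
      K  = N ! * ((suc N ∸ countNonzero (pre ++ c ∷ post)) C d)

fillings : ℕ → ℕ → Generator
fillings zero    a cs zero    = map (const []) cs ∷ []
fillings zero    a cs (suc d) = []
fillings (suc N) a cs d       = Insertion.placeAnywhere (fillings N (suc a)) a [] cs d

empty-Filling : ∀ a cs → sum cs ≡ 0 → Filling a 0 cs 0 (map (const []) cs)
empty-Filling a []         _ = filling refl [] ↭-refl refl
empty-Filling a (zero ∷ cs) s with filling shape um vals desc ← empty-Filling a cs s =
  filling (cong (0 ∷_) shape) (decreasing [] ∷ um) vals desc

Filling-empty : ∀ {a cs d} xss → Filling a 0 cs d xss → xss ≡ map (const []) cs × d ≡ 0
Filling-empty {a} xss (filling refl _ vals refl) = all-empty xss (↭-empty-inv vals)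
  where
  all-empty : ∀ xss → concat xss ≡ [] → xss ≡ map (const []) (map length xss) × sum (map des xss) ≡ 0
  all-empty []          _ = refl , refl
  all-empty ([] ∷ xss) e with xss≡ , d≡ ← all-empty xss e = cong ([] ∷_) xss≡ , d≡

fillings-sound : ∀ N a {cs d xss} → sum cs ≡ N → xss ∈ fillings N a cs d → Filling a N cs d xss
fillings-sound zero    a {cs} {zero} s (here refl) = empty-Filling a cs s
fillings-sound (suc N) a              s x∈          =
  Insertion.placeAnywhere-sound (fillings N (suc a)) a (fillings-sound N (suc a)) [] _ s x∈

fillings-unique : ∀ N a {cs} d → sum cs ≡ N → Unique (fillings N a cs d)
fillings-unique zero    a zero    _ = [] ∷ []
fillings-unique zero    a (suc d) _ = []
fillings-unique (suc N) a {cs} d s = Insertion.placeAnywhere-unique (fillings N (suc a)) a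
  (fillings-sound N (suc a)) (λ d′ → fillings-unique N (suc a) d′) [] cs d s

fillings-count : ∀ N a {cs} d → sum cs ≡ N →
  length (fillings N a cs d) * prodFact cs ≡ N ! * ((N ∸ countNonzero cs) C d)
fillings-count zero    a {cs} zero    s = trans (+-identityʳ _) (prodFact-zeros cs s)
  where
  prodFact-zeros : ∀ cs → sum cs ≡ 0 → prodFact cs ≡ 1
  prodFact-zeros []          _ = refl
  prodFact-zeros (zero ∷ cs) s = trans (+-identityʳ _) (prodFact-zeros cs s)
fillings-count zero    a {cs} (suc d) s
  rewrite n≤0⇒n≡0 (subst (countNonzero cs ≤_) s (countNonzero≤sum cs)) = refl
fillings-count (suc N) a {cs} d       s = begin
  length (fillings (suc N) a cs d) * prodFact cs
    ≡⟨ Insertion.placeAnywhere-count (fillings N (suc a)) a (λ d′ → fillings-count N (suc a) d′)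
         d s [] cs refl ⟩
  sum cs * (N ! * ((suc N ∸ countNonzero cs) C d))
    ≡⟨ cong (_* (N ! * ((suc N ∸ countNonzero cs) C d))) s ⟩
  suc N * (N ! * ((suc N ∸ countNonzero cs) C d))
    ≡⟨ *-assoc (suc N) (N !) _ ⟨
  suc N ! * ((suc N ∸ countNonzero cs) C d)
    ∎
  where open ≡-Reasoning

placed-∈-fillings : ∀ {N a pre c post d x} → Insertion.Placed (fillings N (suc a)) a pre c post d x →
  x ∈ fillings (suc N) a (pre ++ c ∷ post) d
placed-∈-fillings {N} {a} {pre} placed = Insertion.placeIn-⊆-placeAnywhere (fillings N (suc a)) a [] pre
  (Insertion.placed-∈-placeIn (fillings N (suc a)) a placed)

∈-fillings-resp : ∀ {N a cs cs′ d d′ x x′} → cs ≡ cs′ → d ≡ d′ → x ≡ x′ →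
  x ∈ fillings N a cs d → x′ ∈ fillings N a cs′ d′
∈-fillings-resp refl refl refl x∈ = x∈

fillings-complete : ∀ N a {cs d xss} → Filling a N cs d xss → xss ∈ fillings N a cs d
fillings-complete zero a {xss = xss} F with refl , refl ← Filling-empty xss F = here refl
fillings-complete (suc N) a {xss = xss} F@(filling _ um vals _)
  with ys , a∈ys , ys∈xss ← ∈-concat⁻′ xss (Any-resp-↭ (↭-sym vals) (here refl))
  with X1 , X2 , refl ← ∈-∃++ ys∈xss
  with IsUnimodal-minimum-at-end ys (All-mid X1 X2 um) a∈ys
         (All-concat-mid X1 ys X2 (All-resp-↭ (↭-sym vals) (range-lower a (suc N))))
... | inj₁ (zs , refl) =
  let F′    = Filling-remove X1 X2 F (IsUnimodal-tail (All-mid X1 X2 um)) ↭-refl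
      above = All-concat-mid X1 zs X2 (Filling-above F′)
  in ∈-fillings-resp {suc N} {a}
       (trans (sym (map-++ length X1 _)) (Filling.shape F))
       (trans (sym (sum-des-replace {k = 0} X1 {ys = zs} X2 (des-∷-min zs above))) (Filling.descents F))
       (modifyAt-++ (a ∷_) X1 zs X2 (sym (length-map length X1)))
       (placed-∈-fillings {N} {a} {map length X1} (Insertion.at-front (fillings-complete N (suc a) F′)))
... | inj₂ (z , zs , refl) =
  let F′    = Filling-remove X1 X2 F (IsUnimodal-init (z ∷ zs) (All-mid X1 X2 um))
                (↭-sym (∷↭∷ʳ a (z ∷ zs)))
      above = All-concat-mid X1 (z ∷ zs) X2 (Filling-above F′)
  in ∈-fillings-resp {suc N} {a}
       (trans (cong (λ l → map length X1 ++ l ∷ map length X2) (sym (length-∷ʳ (z ∷ zs) a)))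
         (trans (sym (map-++ length X1 _)) (Filling.shape F)))
       (trans (sym (sum-des-replace {k = 1} X1 {ys = z ∷ zs} X2 (des-∷ʳ-min z zs above)))
         (Filling.descents F))
       (modifyAt-++ (_∷ʳ a) X1 (z ∷ zs) X2 (sym (length-map length X1)))
       (placed-∈-fillings {N} {a} {map length X1} (Insertion.at-back (fillings-complete N (suc a) F′)))

fillings-count-0 : ∀ n a {cs} → sum cs ≡ n → length (fillings n a cs 0) * prodFact cs ≡ n !
fillings-count-0 n a s = trans (fillings-count n a 0 s) (*-identityʳ (n !))

multinomial≡length-fillings : ∀ n a {cs} → sum cs ≡ n → multinomial n cs ≡ length (fillings n a cs 0)
multinomial≡length-fillings n a {cs} s = begin
  (n ! / prodFact cs) {{prodFact≢0 cs}}
    ≡⟨ cong (λ m → (m / prodFact cs) {{prodFact≢0 cs}}) (fillings-count-0 n a s) ⟨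
  (length (fillings n a cs 0) * prodFact cs / prodFact cs) {{prodFact≢0 cs}}
    ≡⟨ m*n/n≡m (length (fillings n a cs 0)) (prodFact cs) {{prodFact≢0 cs}} ⟩
  length (fillings n a cs 0)
    ∎
  where open ≡-Reasoning

fillings-length : ∀ n a {cs} d → sum cs ≡ n →
  length (fillings n a cs d) ≡ multinomial n cs * ((n ∸ countNonzero cs) C d)
fillings-length n a {cs} d s = *-cancelʳ-≡ _ _ (prodFact cs) {{prodFact≢0 cs}} (begin
  length (fillings n a cs d) * prodFact cs  ≡⟨ fillings-count n a d s ⟩
  n ! * binomial                            ≡⟨ cong (_* binomial) (fillings-count-0 n a s) ⟨
  F₀ * prodFact cs * binomial               ≡⟨ *-right-comm F₀ (prodFact cs) binomial ⟩
  F₀ * binomial * prodFact cs               ≡⟨ cong (λ m → m * binomial * prodFact cs) (multinomial≡length-fillings n a s) ⟨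
  multinomial n cs * binomial * prodFact cs ∎)
  where
  open ≡-Reasoning
  F₀       = length (fillings n a cs 0)
  binomial = (n ∸ countNonzero cs) C d

Unique-map⁺-retract : ∀ {A B : Set} (f : A → B) (g : B → A) {xs} →
  (∀ {x} → x ∈ xs → g (f x) ≡ x) → Unique xs → Unique (map f xs)
Unique-map⁺-retract f g {xs} retract u = Unique.map⁻ {f = g} (subst Unique (sym g∘f≡id) u)
  where
  g∘f≡id : map g (map f xs) ≡ xs
  g∘f≡id = trans (sym (map-∘ xs)) (trans (map-cong-local (All.tabulate retract)) (map-id xs))

-- Back to words

-- Entries are reduced mod k and missing ones padded with 0; neither happens for the lists of
-- length m with entries below k to which it is applied.
fromEntries : ∀ {k} .{{_ : NonZero k}} m → List ℕ → Vec (Fin k) m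
fromEntries     zero    _        = []
fromEntries {k} (suc m) []       = 0 mod k ∷ fromEntries m []
fromEntries {k} (suc m) (x ∷ xs) = x mod k ∷ fromEntries m xs

toℕ-fromEntries : ∀ {k} .{{_ : NonZero k}} m xs → length xs ≡ m → All (_< k) xs →
  map toℕ (toList (fromEntries {k} m xs)) ≡ xs
toℕ-fromEntries {k} zero    []       _   _           = refl
toℕ-fromEntries {k} (suc m) (x ∷ xs) len (x<k ∷ xs<k) = cong₂ _∷_
  (trans (toℕ-fromℕ< _) (m<n⇒m%n≡m x<k)) (toℕ-fromEntries m xs (suc-injective len) xs<k)

wordOf : ∀ {n} .{{_ : NonZero n}} → Blocks → Word n
wordOf {n} xss = fromEntries n (concat xss)

module _ {n} .{{_ : NonZero n}} where

  entries-wordOf : ∀ {cs d xss} → Filling 0 n cs d xss → entries (wordOf {n} xss) ≡ concat xss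
  entries-wordOf {xss = xss} (filling _ _ vals _) = toℕ-fromEntries n (concat xss)
    (trans (↭-length vals) (length-range 0 n)) (All-resp-↭ (↭-sym vals) (range-upper 0 n))

  segments-entries-wordOf : ∀ {cs d xss} → Filling 0 n cs d xss →
    segments cs (entries (wordOf {n} xss)) ≡ xss
  segments-entries-wordOf {xss = xss} F@(filling refl _ _ _) =
    trans (cong (segments (map length xss)) (entries-wordOf F)) (segments-concat xss)

  desλ-entries : ∀ (π : Word n) xss → entries π ≡ concat xss → All (0 <_) (map length xss) →
    desλ (map length xss) π ≡ sum (map des xss)
  desλ-entries π xss π≡ positive =
    trans (cong (countOutside (boundaries (map length xss)) ∘ Des) π≡)
      (countOutside-boundaries xss positive)

  Filling⇒unimodalPerm : ∀ {cs d xss} → All (0 <_) cs → Filling 0 n cs d xss →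
    let π = wordOf {n} xss in IsPerm π × LambdaUnimodal cs π × desλ cs π ≡ d
  Filling⇒unimodalPerm {xss = xss} positive F@(filling refl um vals refl) =
    entries↭range⇒IsPerm π (subst (_↭ range 0 n) (sym (entries-wordOf F)) vals) ,
    subst (All Unimodal) (sym (segments-entries-wordOf F)) (All.map IsUnimodal⇒Unimodal um) ,
    desλ-entries π xss (entries-wordOf F) positive
    where π = wordOf {n} xss

  unimodalPerm⇒Filling : ∀ {cs d} (π : Word n) → All (0 <_) cs → sum cs ≡ n →
    IsPerm π × LambdaUnimodal cs π × desλ cs π ≡ d → Filling 0 n cs d (segments cs (entries π))
  unimodalPerm⇒Filling {cs} π positive sum≡ (perm , unimodal , desλ≡) = filling
    shape
    (All.map (Unimodal⇒IsUnimodal _) unimodal)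
    (subst (_↭ range 0 n) (sym concat≡) (IsPerm⇒entries↭range π perm))
    (trans (sym (desλ-entries π _ (sym concat≡) (subst (All (0 <_)) (sym shape) positive)))
      (trans (cong (λ λs → desλ λs π) shape) desλ≡))
    where
    length≡ = trans (length-entries π) (sym sum≡)
    shape   = map-length-segments cs (entries π) length≡
    concat≡ = concat-segments cs (entries π) length≡

  wordOf-segments : ∀ {cs} (π : Word n) → sum cs ≡ n → wordOf {n} (segments cs (entries π)) ≡ π
  wordOf-segments {cs} π sum≡ = entries-injective (trans (toℕ-fromEntries n _ length≡ below) concat≡)
    where
    concat≡ = concat-segments cs (entries π) (trans (length-entries π) (sym sum≡))
    length≡ = trans (cong length concat≡) (length-entries π)
    below   = subst (All (_< n)) (sym concat≡) (entries-< π)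

proposition3p2 : (n : ℕ) → n ≥ 1 → (λs : List ℕ) → IsComposition n λs → (d : ℕ) →
    Σ (List (Word n)) (λ L →
      Unique L
      × ((π : Word n) → (π ∈ L) ⇔ (IsPerm π × LambdaUnimodal λs π × desλ λs π ≡ d))
      × length L ≡ multinomial n λs * ((n ∸ length λs) C d))
proposition3p2 (suc n) _ λs (positive , sum≡) d = L , L-unique , L-members , L-length
  where
  G = fillings (suc n) 0 λs d
  L = map wordOf G
  L-unique : Unique L
  L-unique = Unique-map⁺-retract wordOf (segments λs ∘ entries)
    (segments-entries-wordOf ∘ fillings-sound (suc n) 0 {λs} sum≡) (fillings-unique (suc n) 0 {λs} d sum≡)
  L-members : (π : Word (suc n)) → (π ∈ L) ⇔ (IsPerm π × LambdaUnimodal λs π × desλ λs π ≡ d)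
  L-members π = mk⇔ to from
    where
    to : π ∈ L → IsPerm π × LambdaUnimodal λs π × desλ λs π ≡ d
    to π∈ with _ , xss∈ , refl ← ∈-map⁻ wordOf π∈ =
      Filling⇒unimodalPerm positive (fillings-sound (suc n) 0 {λs} sum≡ xss∈)
    from : IsPerm π × LambdaUnimodal λs π × desλ λs π ≡ d → π ∈ L
    from props = subst (_∈ L) (wordOf-segments {cs = λs} π sum≡)
      (∈-map⁺ wordOf (fillings-complete (suc n) 0 (unimodalPerm⇒Filling {cs = λs} π positive sum≡ props)))
  L-length : length L ≡ multinomial (suc n) λs * ((suc n ∸ length λs) C d)
  L-length = begin
    length L                                                 ≡⟨ length-map wordOf G ⟩
    length G                                                 ≡⟨ fillings-length (suc n) 0 {λs} d sum≡ ⟩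
    multinomial (suc n) λs * ((suc n ∸ countNonzero λs) C d) ≡⟨ cong (λ k → multinomial (suc n) λs * ((suc n ∸ k) C d))
                                                                 (countNonzero-positive positive) ⟩
    multinomial (suc n) λs * ((suc n ∸ length λs) C d)       ∎
    where open ≡-Reasoning
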